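{- Let $p$ be a binary word of length $l$, and for each $i \ge 1$ let $r_i$ be the number of runs of $p$ of size $i$. Then for every integer $k \ge 2$, $$B_{l+1,p}(k) = r_{k-1}.$$
   Context: A binary word is a finite sequence $w = w_1 \cdots w_n$ with each $w_i \in \{0,1\}$; $n$ is its length. An occurrence of $p = p_1\cdots p_l$ in $w$ is a choice of indices $1 \le i_1 < \cdots < i_l \le n$ with $w_{i_1}\cdots w_{i_l} = p$. $c_p(w)$ is the number of occurrences of $p$ in $w$, and $B_{n,p}(k)$ is the number of binary words $w$ of length $n$ with $c_p(w)=k$. A run of $w$ is a maximal block of consecutive equal letters; its size is its length. -}

module Defs where

open import Data.Bool using (Bool; true; false; if_then_else_)
open import Data.Bool.Properties using () renaming (_≟_ to _≟ᵇ_)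
open import Data.Nat using (ℕ; zero; suc; _+_)
open import Data.Nat.Properties using (_≟_)
open import Data.List using (List; []; _∷_; length; filter; map)
open import Relation.Nullary.Decidable using (does)

-- Binary words: lists of Bool (false = 0, true = 1).
Word : Set
Word = List Bool

allWords : ℕ → List Word
allWords zero    = [] ∷ []
allWords (suc n) = map (false ∷_) (allWords n) Data.List.++ map (true ∷_) (allWords n)

-- c p w : number of occurrences of p in w as a (scattered) subsequence,
-- i.e. number of index choices i₁ < … < i_l with w_{i₁}…w_{i_l} = p.
-- Standard recursion: either the first letter of w is not used, or it is
-- matched to the first letter of p.
c : Word → Word → ℕ
c []      w       = 1
c (a ∷ p) []      = 0
c (a ∷ p) (b ∷ w) = c (a ∷ p) w + (if does (a ≟ᵇ b) then c p w else 0)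

B : ℕ → Word → ℕ → ℕ
B n p k = length (filter (λ w → c p w ≟ k) (allWords n))

-- Run decomposition: list of sizes of the maximal blocks of equal letters,
-- in order.  runsAux a m w : current run has letter a and size m so far.
runsAux : Bool → ℕ → Word → List ℕ
runsAux a m []      = m ∷ []
runsAux a m (b ∷ w) = if does (a ≟ᵇ b) then runsAux a (suc m) w else m ∷ runsAux b 1 w

runSizes : Word → List ℕ
runSizes []      = []
runSizes (a ∷ w) = runsAux a 1 w

r : Word → ℕ → ℕ
r p i = length (filter (λ s → s ≟ i) (runSizes p))

-- Induct on the pattern q = a ∷ p.  A word of length |q| + 1 containing q at least
-- twice must start with a, and c q (a ∷ w) = c q w + c p w, where c q w = [w = q]
-- because |w| = |q|.  So the count of such words differs from the count for p
-- only at w = q, where c p q = 1 + (size of the leading a-block of p).  The run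
-- sizes of q differ from those of p in the same way: the first run of q is the
-- leading a-block of p grown by one letter.
module Submission where

open import Defs
open import Data.Nat using (ℕ; suc; _≤_)
open import Data.List using (length)
open import Relation.Binary.PropositionalEquality using (_≡_)

open import Data.Bool using (Bool; true; false; not; if_then_else_)
open import Data.Bool.Properties using (not-¬) renaming (_≟_ to _≟ᵇ_)
open import Data.Empty using (⊥-elim)
open import Data.List using (List; []; _∷_; _++_; filter; map)
open import Data.List.Properties using (map-++; map-∘; map-cong-local; ∷-injectiveˡ; ∷-injectiveʳ)
open import Data.List.Relation.Unary.All as All using (All; []; _∷_)
open import Data.List.Relation.Unary.All.Properties using (++⁺; map⁺)
open import Data.Nat using (zero; _+_; _<_; z≤n; s≤s)
open import Data.Nat.ListAction using (sum)
open import Data.Nat.ListAction.Properties using (sum-++)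
open import Data.Nat.Properties
  using (_≟_; +-commutativeSemigroup; +-comm; +-suc; +-identityʳ; +-cancelʳ-≡;
         ≤-refl; ≤-reflexive; m≤n⇒m≤1+n; suc-injective)
open import Algebra.Properties.CommutativeSemigroup +-commutativeSemigroup
  using (xy∙z≈xz∙y; xy∙z≈zy∙x)
open import Function using (_∘_)
open import Relation.Binary.PropositionalEquality
  using (_≢_; refl; sym; trans; cong; cong₂; module ≡-Reasoning)
open import Relation.Nullary using (yes; no)
open import Relation.Nullary.Decidable using (does)

open ≡-Reasoning

-- δ (suc m) (suc n) reduces to δ m n; the proofs below rely on this silently.
δ : ℕ → ℕ → ℕ
δ m n = if does (m ≟ n) then 1 else 0

δ-≤1-suc-suc : ∀ {m} j → m ≤ 1 → δ m (suc (suc j)) ≡ 0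
δ-≤1-suc-suc j z≤n       = refl
δ-≤1-suc-suc j (s≤s z≤n) = refl

length-filter-≟ : {A : Set} (f : A → ℕ) (k : ℕ) (xs : List A) →
  length (filter (λ x → f x ≟ k) xs) ≡ sum (map (λ x → δ (f x) k) xs)
length-filter-≟ f k []       = refl
length-filter-≟ f k (x ∷ xs) with does (f x ≟ k)
... | true  = cong suc (length-filter-≟ f k xs)
... | false = length-filter-≟ f k xs

sum-map-zero : {A : Set} (xs : List A) → sum (map (λ _ → 0) xs) ≡ 0
sum-map-zero []       = refl
sum-map-zero (_ ∷ xs) = sum-map-zero xs

Σ-words : ℕ → (Word → ℕ) → ℕ
Σ-words n f = sum (map f (allWords n))

allWords-length : ∀ n → All (λ w → length w ≡ n) (allWords n)
allWords-length zero    = refl ∷ []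
allWords-length (suc n) = ++⁺ (prepend false) (prepend true)
  where
  prepend : ∀ a → All (λ w → length w ≡ suc n) (map (a ∷_) (allWords n))
  prepend a = map⁺ (All.map (cong suc) (allWords-length n))

Σ-words-cong : ∀ {n} {f g : Word → ℕ} →
  (∀ w → length w ≡ n → f w ≡ g w) → Σ-words n f ≡ Σ-words n g
Σ-words-cong {n} f≗g = cong sum (map-cong-local (All.map (f≗g _) (allWords-length n)))

Σ-words-vanish : ∀ {n} {f : Word → ℕ} → (∀ w → length w ≡ n → f w ≡ 0) → Σ-words n f ≡ 0
Σ-words-vanish {n} f≗0 = trans (Σ-words-cong f≗0) (sum-map-zero (allWords n))

Σ-words-suc-split : ∀ n (f : Word → ℕ) →
  Σ-words (suc n) f ≡ Σ-words n (f ∘ (false ∷_)) + Σ-words n (f ∘ (true ∷_))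
Σ-words-suc-split n f = begin
  sum (map f (map (false ∷_) W ++ map (true ∷_) W))
    ≡⟨ cong sum (map-++ f (map (false ∷_) W) _) ⟩
  sum (map f (map (false ∷_) W) ++ map f (map (true ∷_) W))
    ≡⟨ sum-++ (map f (map (false ∷_) W)) _ ⟩
  sum (map f (map (false ∷_) W)) + sum (map f (map (true ∷_) W))
    ≡⟨ cong₂ (λ xs ys → sum xs + sum ys) (map-∘ W) (map-∘ W) ⟨
  Σ-words n (f ∘ (false ∷_)) + Σ-words n (f ∘ (true ∷_)) ∎
  where W = allWords n

Σ-words-suc : ∀ n (a : Bool) (f : Word → ℕ) →
  Σ-words (suc n) f ≡ Σ-words n (f ∘ (a ∷_)) + Σ-words n (f ∘ (not a ∷_))
Σ-words-suc n false f = Σ-words-suc-split n f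
Σ-words-suc n true  f = trans (Σ-words-suc-split n f) (+-comm (Σ-words n (f ∘ (false ∷_))) _)

Σ-words-update : (q : Word) (f g : Word → ℕ) →
  (∀ w → length w ≡ length q → w ≢ q → f w ≡ g w) →
  Σ-words (length q) f + g q ≡ Σ-words (length q) g + f q
Σ-words-update [] f g _
  rewrite +-identityʳ (f []) | +-identityʳ (g []) = +-comm (f []) (g [])
Σ-words-update (b ∷ q) f g f≗g = begin
  Σ-words (suc n) f + g (b ∷ q)
    ≡⟨ cong (_+ g (b ∷ q)) (Σ-words-suc n b f) ⟩
  Σ-words n (f ∘ (b ∷_)) + Σ-words n (f ∘ (not b ∷_)) + g (b ∷ q)
    ≡⟨ xy∙z≈xz∙y (Σ-words n (f ∘ (b ∷_))) _ _ ⟩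
  Σ-words n (f ∘ (b ∷_)) + g (b ∷ q) + Σ-words n (f ∘ (not b ∷_))
    ≡⟨ cong₂ _+_ (Σ-words-update q (f ∘ (b ∷_)) (g ∘ (b ∷_)) same-head)
                 (Σ-words-cong other-head) ⟩
  Σ-words n (g ∘ (b ∷_)) + f (b ∷ q) + Σ-words n (g ∘ (not b ∷_))
    ≡⟨ xy∙z≈xz∙y (Σ-words n (g ∘ (b ∷_))) _ _ ⟨
  Σ-words n (g ∘ (b ∷_)) + Σ-words n (g ∘ (not b ∷_)) + f (b ∷ q)
    ≡⟨ cong (_+ f (b ∷ q)) (Σ-words-suc n b g) ⟨
  Σ-words (suc n) g + f (b ∷ q) ∎
  where
  n = length q
  same-head : ∀ w → length w ≡ n → w ≢ q → f (b ∷ w) ≡ g (b ∷ w)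
  same-head w |w| w≢q = f≗g (b ∷ w) (cong suc |w|) (w≢q ∘ ∷-injectiveʳ)
  other-head : ∀ w → length w ≡ n → f (not b ∷ w) ≡ g (not b ∷ w)
  other-head w |w| = f≗g (not b ∷ w) (cong suc |w|) (not-¬ refl ∘ sym ∘ ∷-injectiveˡ)

c-cons-match : (a : Bool) (p w : Word) → c (a ∷ p) (a ∷ w) ≡ c (a ∷ p) w + c p w
c-cons-match false p w = refl
c-cons-match true  p w = refl

c-cons-mismatch : (a : Bool) (p w : Word) → c (a ∷ p) (not a ∷ w) ≡ c (a ∷ p) w
c-cons-mismatch false p w = +-identityʳ _
c-cons-mismatch true  p w = +-identityʳ _

c-short : (p w : Word) → length w < length p → c p w ≡ 0
c-short (a ∷ p) []      _         = refl
c-short (a ∷ p) (b ∷ w) (s≤s |w|<|p|)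
  rewrite c-short (a ∷ p) w (m≤n⇒m≤1+n |w|<|p|) with does (a ≟ᵇ b)
... | true  = c-short p w |w|<|p|
... | false = refl

c-sameLength-≤1 : (p w : Word) → length w ≡ length p → c p w ≤ 1
c-sameLength-≤1 []      []      _ = s≤s z≤n
c-sameLength-≤1 (a ∷ p) (b ∷ w) |w|≡|p|
  rewrite c-short (a ∷ p) w (≤-reflexive |w|≡|p|) with does (a ≟ᵇ b)
... | true  = c-sameLength-≤1 p w (suc-injective |w|≡|p|)
... | false = z≤n

c-sameLength-≢ : (p w : Word) → length w ≡ length p → w ≢ p → c p w ≡ 0
c-sameLength-≢ []      []      _ w≢p = ⊥-elim (w≢p refl)
c-sameLength-≢ (a ∷ p) (b ∷ w) |w|≡|p| w≢p
  rewrite c-short (a ∷ p) w (≤-reflexive |w|≡|p|) with a ≟ᵇ b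
... | yes refl = c-sameLength-≢ p w (suc-injective |w|≡|p|) (w≢p ∘ cong (a ∷_))
... | no _     = refl

c-self : (p : Word) → c p p ≡ 1
c-self []      = refl
c-self (a ∷ p) rewrite c-cons-match a p p | c-short (a ∷ p) p ≤-refl = c-self p

leading : Bool → Word → ℕ
leading a []      = 0
leading a (b ∷ w) = if does (a ≟ᵇ b) then suc (leading a w) else 0

c-cons-self : (a : Bool) (p : Word) → c p (a ∷ p) ≡ suc (leading a p)
c-cons-self a     []          = refl
c-cons-self false (false ∷ p) = cong₂ _+_ (c-self (false ∷ p)) (c-cons-self false p)
c-cons-self true  (true  ∷ p) = cong₂ _+_ (c-self (true ∷ p)) (c-cons-self true p)
c-cons-self false (true  ∷ p) = cong (_+ 0) (c-self (true ∷ p))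
c-cons-self true  (false ∷ p) = cong (_+ 0) (c-self (false ∷ p))

laterRuns : Bool → Word → List ℕ
laterRuns a []      = []
laterRuns a (b ∷ w) = if does (a ≟ᵇ b) then laterRuns a w else runsAux b 1 w

runsAux-first : (a : Bool) (m : ℕ) (w : Word) →
  runsAux a m w ≡ (m + leading a w) ∷ laterRuns a w
runsAux-first a m []      = cong (_∷ []) (sym (+-identityʳ m))
runsAux-first a m (b ∷ w) with does (a ≟ᵇ b)
... | true  = trans (runsAux-first a (suc m) w) (cong (_∷ laterRuns a w) (sym (+-suc m _)))
... | false = cong (_∷ runsAux b 1 w) (sym (+-identityʳ m))

count-runsAux : (a : Bool) (m : ℕ) (w : Word) (i : ℕ) →
  length (filter (λ s → s ≟ i) (runsAux a m w))
    ≡ δ (m + leading a w) i + sum (map (λ s → δ s i) (laterRuns a w))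
count-runsAux a m w i rewrite runsAux-first a m w =
  length-filter-≟ (λ s → s) i ((m + leading a w) ∷ laterRuns a w)

-- runsAux a 0 p differs from runSizes p at most by a leading run of size 0.
r-runsAux-zero : (a : Bool) (p : Word) (j : ℕ) →
  r p (suc j) ≡ length (filter (λ s → s ≟ suc j) (runsAux a 0 p))
r-runsAux-zero a     []          j = refl
r-runsAux-zero false (false ∷ p) j = refl
r-runsAux-zero false (true  ∷ p) j = refl
r-runsAux-zero true  (false ∷ p) j = refl
r-runsAux-zero true  (true  ∷ p) j = refl

r-cons : (a : Bool) (p : Word) (j : ℕ) →
  r (a ∷ p) (suc j) + δ (leading a p) (suc j) ≡ r p (suc j) + δ (suc (leading a p)) (suc j)
r-cons a p j = begin
  r (a ∷ p) i + δ L i                        ≡⟨ cong (_+ δ L i) (count-runsAux a 1 p i) ⟩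
  δ (suc L) i + R + δ L i                    ≡⟨ xy∙z≈zy∙x (δ (suc L) i) R (δ L i) ⟩
  δ L i + R + δ (suc L) i                    ≡⟨ cong (_+ δ (suc L) i) (count-runsAux a 0 p i) ⟨
  length (filter (λ s → s ≟ i) (runsAux a 0 p)) + δ (suc L) i
                                             ≡⟨ cong (_+ δ (suc L) i) (r-runsAux-zero a p j) ⟨
  r p i + δ (suc L) i                        ∎
  where
  i = suc j
  L = leading a p
  R = sum (map (λ s → δ s i) (laterRuns a p))

Σ-words-occurrences≡runs : (p : Word) (j : ℕ) →
  Σ-words (suc (length p)) (λ w → δ (c p w) (suc (suc j))) ≡ r p (suc j)
Σ-words-occurrences≡runs []      j = refl
-- Adding δ L (suc j) to both sides lets the single-word corrections of
-- Σ-words-update and r-cons be matched without subtraction.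
Σ-words-occurrences≡runs (a ∷ p) j = +-cancelʳ-≡ (δ L (suc j)) _ _ (begin
  Σ-words (suc n) (λ w → δ (c q w) k) + δ L (suc j)
    ≡⟨ cong (_+ δ L (suc j)) (Σ-words-suc n a (λ w → δ (c q w) k)) ⟩
  Σ-words n (λ w → δ (c q (a ∷ w)) k) + Σ-words n (λ w → δ (c q (not a ∷ w)) k) + δ L (suc j)
    ≡⟨ cong (_+ δ L (suc j)) (cong₂ _+_ matched unmatched) ⟩
  Σ-words n (λ w → δ (c q w + c p w) k) + 0 + δ L (suc j)
    ≡⟨ cong₂ _+_ (+-identityʳ _) (cong (λ x → δ x k) (sym (c-cons-self a p))) ⟩
  Σ-words n (λ w → δ (c q w + c p w) k) + δ (c p q) k
    ≡⟨ Σ-words-update q (λ w → δ (c q w + c p w) k) (λ w → δ (c p w) k) drop-c-q ⟩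
  Σ-words n (λ w → δ (c p w) k) + δ (c q q + c p q) k
    ≡⟨ cong₂ _+_ (Σ-words-occurrences≡runs p j)
                 (cong₂ (λ x y → δ (x + y) k) (c-self q) (c-cons-self a p)) ⟩
  r p (suc j) + δ (suc L) (suc j)
    ≡⟨ r-cons a p j ⟨
  r q (suc j) + δ L (suc j) ∎)
  where
  q = a ∷ p
  n = length q
  k = suc (suc j)
  L = leading a p
  matched : Σ-words n (λ w → δ (c q (a ∷ w)) k) ≡ Σ-words n (λ w → δ (c q w + c p w) k)
  matched = Σ-words-cong {n} (λ w _ → cong (λ x → δ x k) (c-cons-match a p w))
  unmatched : Σ-words n (λ w → δ (c q (not a ∷ w)) k) ≡ 0
  unmatched = Σ-words-vanish {n} λ w |w| →
    trans (cong (λ x → δ x k) (c-cons-mismatch a p w)) (δ-≤1-suc-suc j (c-sameLength-≤1 q w |w|))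
  drop-c-q : ∀ w → length w ≡ n → w ≢ q → δ (c q w + c p w) k ≡ δ (c p w) k
  drop-c-q w |w| w≢q = cong (λ x → δ (x + c p w) k) (c-sameLength-≢ q w |w| w≢q)

mainTheorem4 : (p : Word) (k : ℕ) → 2 ≤ k → B (suc (length p)) p k ≡ r p (k Data.Nat.∸ 1)
mainTheorem4 p (suc (suc j)) (s≤s (s≤s z≤n)) =
  trans (length-filter-≟ (c p) (suc (suc j)) (allWords (suc (length p)))) (Σ-words-occurrences≡runs p j)
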